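{- Let $(\mathfrak{M},m)$ be a pointed model, $(\mathfrak{N},n)$ a pointed pre-model and $(\mathfrak{S},s)$ a pointed pseudo model. If $(\mathfrak{M},m)$ and $(\mathfrak{N},n)$ are trans-bisimilar and $(\mathfrak{N},n)$ and $(\mathfrak{S},s)$ are bisimilar, then for every formula $\phi$ of $\mathcal{RCD}$, $\mathfrak{M},m\models\phi$ iff $\mathfrak{N},n\models_{\mathsf p}\phi$.
   Context: Fix a finite set $\textsc{ag}$ of agents and a countable set $\textsc{prop}$ of propositional variables; $\textsc{gr}$ is the set of nonempty subsets of $\textsc{ag}$. $\mathcal{RCD}$: $\phi ::= p \mid \neg\phi \mid \phi\wedge\phi \mid K_i\phi \mid D_G\phi \mid C_G\phi \mid R_G\phi$. Models: $\mathfrak{M}=(M,\sim,V)$ with an equivalence relation $\sim_i$ for each agent and $V:\textsc{prop}\to 2^M$; $\sim_G=\bigcap_{i\in G}\sim_i$; $\mathfrak{M}|_G$ replaces $\sim_i$ by $\sim_G$ for $i\in G$. Satisfaction $\models$: atoms via $V$, Booleans as usual, $K_i,D_G$ boxes over $\sim_i,\sim_G$, $C_G$ box over the reflexive transitive closure of $\bigcup_{i\in G}\sim_i$, $\mathfrak{M},m\models R_G\phi$ iff $\mathfrak{M}|_G,m\models\phi$. Pre-models: $\mathfrak{N}=(N,\backsim,\nu)$ with $N$ nonempty, a primitive equivalence relation $\backsim_\tau$ for each $\tau\in\textsc{ag}\cup\textsc{gr}$, and $\nu:\textsc{prop}\to\wp(N)$. A pseudo model is a pre-model with $\backsim_{\{i\}}=\backsim_i$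 and $\backsim_H\subseteq\backsim_G$ whenever $G\subseteq H$. Update: $\mathfrak{N}|_G$ has $(\backsim|_G)_i=\backsim_G$ if $i\in G$, else $\backsim_i$; $(\backsim|_G)_H=\backsim_{H\cup G}$ if $H\cap G\neq\emptyset$, else $\backsim_H$. Pseudo satisfaction $\models_{\mathsf p}$: as for models but $K_i,D_G$ are boxes over the primitive $\backsim_i,\backsim_G$, $C_G$ over the reflexive transitive closure of $\bigcup_{i\in G}\backsim_i$, and $R_G$ via $\mathfrak{N}|_G$. Bisimulation between pre-models: nonempty $Z$ such that linked states agree on atoms and, for every $\tau\in\textsc{ag}\cup\textsc{gr}$, forth and back conditions hold for $\backsim_\tau$. A trans-bisimulation between a model $\mathfrak{M}=(M,\sim,V)$ and a pre-model $\mathfrak{N}=(N,\backsim,\nu)$ is a nonempty $Z\subseteq M\times N$ such that whenever $mZn$: (at) $m\in V(p)$ iff $n\in\nu(p)$ for all $p$; (zig$_{ag}$) for all $m'$ and agents $i$ with $m\sim_im'$, there is $n'$ with $m'Zn'$ and $n\backsim_{\tau_0}\cdots\backsim_{\tau_x}n'$, where each $\tau_j$ is either the agent $i$ or a group $G$ with $i\in G$; (zig$_{gr}$) for all $m'$ and groups $G$ with $|G|\geq 2$ and $m\sim_Gm'$, there is $n'$ with $m'Zn'$ and $n\backsim_{G_1}\cdots\backsim_{G_x}n'$ with $G\subseteq G_1\cap\cdots\cap G_x$; (zag) for all $n'$ and $\tau\in\textsc{ag}\cup\textsc{gr}$ with $n\backsim_\tau n'$, there is $m'$ with $m'Zn'$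 and $m\sim_\tau m'$. $(\mathfrak{M},m)$ and $(\mathfrak{N},n)$ are trans-bisimilar if some trans-bisimulation links $m$ and $n$. -}

module Defs where

open import Data.Nat using (ℕ; _≤_)
open import Data.Fin using (Fin)
open import Data.Fin.Subset using (Subset; _∈_; _⊆_; _∩_; _∪_; Nonempty; ∣_∣; ⁅_⁆)
open import Data.Fin.Subset.Properties using (_∈?_; nonempty?)
open import Data.Product using (Σ; ∃; _×_; _,_)
open import Data.Sum using (_⊎_)
open import Relation.Nullary using (yes; no)
open import Relation.Binary using (IsEquivalence)
open import Relation.Binary.Construct.Closure.ReflexiveTransitive using (Star)
open import Relation.Binary.Construct.Closure.Transitive using (Plus)
open import Function.Bundles using (_⇔_)

Prop : Set
Prop = ℕ

module _ {k : ℕ} where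

  data Form : Set where
    atom : Prop → Form
    ¬'_  : Form → Form
    _∧'_ : Form → Form → Form
    K    : Fin k → Form → Form
    D    : (G : Subset k) → Nonempty G → Form → Form
    C    : (G : Subset k) → Nonempty G → Form → Form
    R    : (G : Subset k) → Nonempty G → Form → Form

  record Frame : Set₁ where
    field
      W   : Set
      rel : Fin k → W → W → Set
      V   : Prop → W → Set

  relGrp : (F : Frame) → Subset k → Frame.W F → Frame.W F → Set
  relGrp F G x y = ∀ i → i ∈ G → Frame.rel F i x y

  updM : Frame → Subset k → Frame
  updM F G = record { W = Frame.W F ; rel = r ; V = Frame.V F }
    where
    r : Fin k → Frame.W F → Frame.W F → Set
    r i with i ∈? G
    ... | yes _ = relGrp F G
    ... | no  _ = Frame.rel F i

  unionStep : (F : Frame) → Subset k → Frame.W F → Frame.W F → Set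
  unionStep F G x y = Σ (Fin k) λ i → i ∈ G × Frame.rel F i x y

  _,_⊨_ : (F : Frame) → Frame.W F → Form → Set
  F , m ⊨ atom p    = Frame.V F p m
  F , m ⊨ (¬' φ)    = F , m ⊨ φ → ⊥'
    where open import Data.Empty renaming (⊥ to ⊥')
  F , m ⊨ (φ ∧' ψ)  = (F , m ⊨ φ) × (F , m ⊨ ψ)
  F , m ⊨ K i φ     = ∀ m' → Frame.rel F i m m' → F , m' ⊨ φ
  F , m ⊨ D G _ φ   = ∀ m' → relGrp F G m m' → F , m' ⊨ φ
  F , m ⊨ C G _ φ   = ∀ m' → Star (unionStep F G) m m' → F , m' ⊨ φ
  F , m ⊨ R G _ φ   = updM F G , m ⊨ φ

  record Model : Set₁ where
    field
      frame : Frame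
      equiv : ∀ i → IsEquivalence (Frame.rel frame i)
    open Frame frame public

  -- Group relations are indexed by Subset k; the value at the empty
  -- subset is never used (every use is guarded by nonemptiness).
  record PreFrame : Set₁ where
    field
      N    : Set
      relA : Fin k → N → N → Set
      relG : Subset k → N → N → Set
      ν    : Prop → N → Set

  updP : PreFrame → Subset k → PreFrame
  updP F G = record { N = PreFrame.N F ; relA = rA ; relG = rG ; ν = PreFrame.ν F }
    where
    rA : Fin k → PreFrame.N F → PreFrame.N F → Set
    rA i with i ∈? G
    ... | yes _ = PreFrame.relG F G
    ... | no  _ = PreFrame.relA F i
    rG : Subset k → PreFrame.N F → PreFrame.N F → Set
    rG H with nonempty? (H ∩ G)
    ... | yes _ = PreFrame.relG F (H ∪ G)
    ... | no  _ = PreFrame.relG F H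

  unionStepP : (F : PreFrame) → Subset k → PreFrame.N F → PreFrame.N F → Set
  unionStepP F G x y = Σ (Fin k) λ i → i ∈ G × PreFrame.relA F i x y

  _,_⊨ₚ_ : (F : PreFrame) → PreFrame.N F → Form → Set
  F , n ⊨ₚ atom p    = PreFrame.ν F p n
  F , n ⊨ₚ (¬' φ)    = F , n ⊨ₚ φ → ⊥'
    where open import Data.Empty renaming (⊥ to ⊥')
  F , n ⊨ₚ (φ ∧' ψ)  = (F , n ⊨ₚ φ) × (F , n ⊨ₚ ψ)
  F , n ⊨ₚ K i φ     = ∀ n' → PreFrame.relA F i n n' → F , n' ⊨ₚ φ
  F , n ⊨ₚ D G _ φ   = ∀ n' → PreFrame.relG F G n n' → F , n' ⊨ₚ φ
  F , n ⊨ₚ C G _ φ   = ∀ n' → Star (unionStepP F G) n n' → F , n' ⊨ₚ φ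
  F , n ⊨ₚ R G _ φ   = updP F G , n ⊨ₚ φ

  record PreModel : Set₁ where
    field
      frame   : PreFrame
      point   : PreFrame.N frame
      equivA  : ∀ i → IsEquivalence (PreFrame.relA frame i)
      equivG  : ∀ G → Nonempty G → IsEquivalence (PreFrame.relG frame G)
    open PreFrame frame public

  record IsPseudo (P : PreModel) : Set where
    open PreModel P
    field
      single : ∀ i x y → (relG ⁅ i ⁆ x y ⇔ relA i x y)
      anti   : ∀ G H → Nonempty G → G ⊆ H → ∀ x y → relG H x y → relG G x y

  record IsBisim (P Q : PreModel) (Z : PreModel.N P → PreModel.N Q → Set) : Set where
    private
      module P = PreModel P
      module Q = PreModel Q
    field
      atoms  : ∀ x y → Z x y → ∀ p → (P.ν p x ⇔ Q.ν p y)
      forthA : ∀ x y → Z x y → ∀ i x' → P.relA i x x' → ∃ λ y' → Z x' y' × Q.relA i y y'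
      backA  : ∀ x y → Z x y → ∀ i y' → Q.relA i y y' → ∃ λ x' → Z x' y' × P.relA i x x'
      forthG : ∀ x y → Z x y → ∀ G → Nonempty G → ∀ x' → P.relG G x x' →
               ∃ λ y' → Z x' y' × Q.relG G y y'
      backG  : ∀ x y → Z x y → ∀ G → Nonempty G → ∀ y' → Q.relG G y y' →
               ∃ λ x' → Z x' y' × P.relG G x x'

  Bisimilar : (P : PreModel) → PreModel.N P → (Q : PreModel) → PreModel.N Q → Set₁
  Bisimilar P x Q y = Σ (PreModel.N P → PreModel.N Q → Set) λ Z → IsBisim P Q Z × Z x y

  agStep : (P : PreModel) → Fin k → PreModel.N P → PreModel.N P → Set
  agStep P i x y = PreModel.relA P i x y ⊎ Σ (Subset k) λ H → i ∈ H × PreModel.relG P H x y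

  grStep : (P : PreModel) → Subset k → PreModel.N P → PreModel.N P → Set
  grStep P G x y = Σ (Subset k) λ H → G ⊆ H × PreModel.relG P H x y

  record IsTransBisim (M : Model) (P : PreModel) (Z : Model.W M → PreModel.N P → Set) : Set where
    private
      module M = Model M
      module P = PreModel P
    field
      at     : ∀ m n → Z m n → ∀ p → (M.V p m ⇔ P.ν p n)
      zigAg  : ∀ m n → Z m n → ∀ i m' → M.rel i m m' →
               ∃ λ n' → Z m' n' × Plus (agStep P i) n n'
      zigGr  : ∀ m n → Z m n → ∀ G → 2 ≤ ∣ G ∣ → ∀ m' → relGrp M.frame G m m' →
               ∃ λ n' → Z m' n' × Plus (grStep P G) n n'
      zagAg  : ∀ m n → Z m n → ∀ i n' → P.relA i n n' →
               ∃ λ m' → Z m' n' × M.rel i m m'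
      zagGr  : ∀ m n → Z m n → ∀ G → Nonempty G → ∀ n' → P.relG G n n' →
               ∃ λ m' → Z m' n' × relGrp M.frame G m m'

  TransBisimilar : (M : Model) → Model.W M → (P : PreModel) → PreModel.N P → Set₁
  TransBisimilar M m P n = Σ (Model.W M → PreModel.N P → Set) λ Z → IsTransBisim M P Z × Z m n

-- Read a model as a pre-model whose group relations are the intersections ∼_G.  This
-- does not change truth: updating the model and then reading it is bisimilar, via the
-- identity, to reading it and then updating the pre-model.  Composing the trans-bisimulation
-- with the bisimulation into the pseudo model S yields an ordinary bisimulation: the chains
-- of primitive steps demanded by zig collapse to single steps in S, whose relations are
-- transitive and whose group relations are antitone in the group (a group with fewer than
-- two agents is a singleton, where zig_ag applies instead of zig_gr).  Truth in pre-models is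
-- invariant under bisimulations, since bisimulations survive updates, so
-- M, m ⊨ φ  ⇔  S, s ⊨ₚ φ  ⇔  N, n ⊨ₚ φ.

module Submission where

open import Defs
open import Data.Nat using (ℕ; _≤_; _<_; _≤?_)
open import Data.Fin using (Fin; _≟_)
open import Data.Fin.Subset using (Subset; _∈_; _∉_; _⊆_; _⊂_; _∩_; _∪_; Nonempty; ∣_∣; ⁅_⁆)
open import Data.Fin.Subset.Properties
  using (_∈?_; nonempty?; x∈p∩q⁺; x∈p∩q⁻; x∈p∪q⁻; p⊆p∪q; q⊆p∪q)
open import Data.Fin.Subset.Properties
  using (x∈⁅x⁆; x∈⁅y⁆⇒x≡y; x∈⁅y⁆⇔x≡y; x≢y⇒x∉⁅y⁆; ∣⁅x⁆∣≡1; p⊂q⇒∣p∣<∣q∣)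
open import Data.Product using (∃-syntax; _×_; _,_)
open import Data.Product.Function.NonDependent.Propositional using (_×-⇔_)
open import Data.Sum using (inj₁; inj₂)
open import Function using (flip)
open import Function.Bundles using (_⇔_; mk⇔; Equivalence)
import Function.Properties.Equivalence as ⇔
open import Function.Related.TypeIsomorphisms using (¬-cong-⇔)
open import Relation.Nullary using (yes; no; ¬_; contradiction)
open import Relation.Binary using (IsEquivalence)
open import Relation.Binary.PropositionalEquality using (_≡_; refl; sym; subst)
open import Relation.Binary.Construct.Closure.ReflexiveTransitive using (Star; ε; _◅_)
open import Relation.Binary.Construct.Closure.Transitive using (Plus; [_]; _∼⁺⟨_⟩_)

open Equivalence using (to; from)

Forth : {A B : Set} → (A → B → Set) → (A → A → Set) → (B → B → Set) → Set
Forth Z R₁ R₂ = ∀ {x y x'} → Z x y → R₁ x x' → ∃[ y' ] Z x' y' × R₂ y y'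

Back : {A B : Set} → (A → B → Set) → (A → A → Set) → (B → B → Set) → Set
Back Z R₁ R₂ = Forth (flip Z) R₂ R₁

module _ {A B : Set} {Z : A → B → Set} {R₁ : A → A → Set} {R₂ : B → B → Set} where

  Star-forth : Forth Z R₁ R₂ → Forth Z (Star R₁) (Star R₂)
  Star-forth forth z ε = _ , z , ε
  Star-forth forth z (r ◅ rs) with forth z r
  ... | _ , z₁ , s with Star-forth forth z₁ rs
  ...   | y' , z' , ss = y' , z' , s ◅ ss

  Plus-forth : Forth Z R₁ R₂ → Forth Z (Plus R₁) (Plus R₂)
  Plus-forth forth z [ r ] with forth z r
  ... | y' , z' , s = y' , z' , [ s ]
  Plus-forth forth z (_ ∼⁺⟨ rs₁ ⟩ rs₂) with Plus-forth forth z rs₁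
  ... | _ , z₁ , ss₁ with Plus-forth forth z₁ rs₂
  ...   | y' , z' , ss₂ = y' , z' , (_ ∼⁺⟨ ss₁ ⟩ ss₂)

  □-cong : {P : A → Set} {Q : B → Set} → Forth Z R₁ R₂ → Back Z R₁ R₂ →
           (∀ {x y} → Z x y → P x ⇔ Q y) →
           ∀ {x y} → Z x y → (∀ x' → R₁ x x' → P x') ⇔ (∀ y' → R₂ y y' → Q y')
  □-cong forth back P⇔Q z = mk⇔
    (λ h y' s → let x' , z' , r = back z s in to (P⇔Q z') (h x' r))
    (λ h x' r → let y' , z' , s = forth z r in from (P⇔Q z') (h y' s))

□-cong-pointwise : {A : Set} {P Q T : A → Set} → (∀ x → P x ⇔ Q x) →
                   (∀ x → T x → P x) ⇔ (∀ x → T x → Q x)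
□-cong-pointwise P⇔Q = mk⇔ (λ h x t → to (P⇔Q x) (h x t)) (λ h x t → from (P⇔Q x) (h x t))

module _ {A : Set} {R₁ R₂ : A → A → Set} where

  Plus-fold : (∀ {x y} → R₁ x y → R₂ x y) → (∀ {x y z} → R₂ x y → R₂ y z → R₂ x z) →
              ∀ {x y} → Plus R₁ x y → R₂ x y
  Plus-fold R₁⇒R₂ trans [ r ] = R₁⇒R₂ r
  Plus-fold R₁⇒R₂ trans (_ ∼⁺⟨ rs₁ ⟩ rs₂) =
    trans (Plus-fold R₁⇒R₂ trans rs₁) (Plus-fold R₁⇒R₂ trans rs₂)

  ≡-forth : (∀ {x y} → R₁ x y → R₂ x y) → Forth _≡_ R₁ R₂
  ≡-forth R₁⇒R₂ refl r = _ , refl , R₁⇒R₂ r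

  ≡-back : (∀ {x y} → R₂ x y → R₁ x y) → Back _≡_ R₁ R₂
  ≡-back R₂⇒R₁ refl s = _ , refl , R₂⇒R₁ s

module _ {k : ℕ} where

  ⁅⁆⊆ : {i : Fin k} {G : Subset k} → i ∈ G → ⁅ i ⁆ ⊆ G
  ⁅⁆⊆ {i} {G} i∈G j∈⁅i⁆ = subst (_∈ G) (sym (x∈⁅y⁆⇒x≡y i j∈⁅i⁆)) i∈G

  ∣∣<2⇒⊆⁅⁆ : {i : Fin k} {G : Subset k} → i ∈ G → ¬ 2 ≤ ∣ G ∣ → G ⊆ ⁅ i ⁆
  ∣∣<2⇒⊆⁅⁆ {i} {G} i∈G ∣G∣<2 {j} j∈G with j ≟ i
  ... | yes j≡i = from x∈⁅y⁆⇔x≡y j≡i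
  ... | no  j≢i = contradiction (subst (_< ∣ G ∣) (∣⁅x⁆∣≡1 i) (p⊂q⇒∣p∣<∣q∣ ⁅i⁆⊂G)) ∣G∣<2
    where
    ⁅i⁆⊂G : ⁅ i ⁆ ⊂ G
    ⁅i⁆⊂G = ⁅⁆⊆ i∈G , j , j∈G , x≢y⇒x∉⁅y⁆ j≢i

  -- IsBisim on bare pre-frames, so that it can be transported along updP.
  record Bisimulation (P Q : PreFrame {k}) (Z : PreFrame.N P → PreFrame.N Q → Set) : Set where
    private
      module P = PreFrame P
      module Q = PreFrame Q
    field
      atoms  : ∀ {x y} → Z x y → ∀ p → P.ν p x ⇔ Q.ν p y
      forthA : ∀ i → Forth Z (P.relA i) (Q.relA i)
      backA  : ∀ i → Back Z (P.relA i) (Q.relA i)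
      forthG : ∀ G → Nonempty G → Forth Z (P.relG G) (Q.relG G)
      backG  : ∀ G → Nonempty G → Back Z (P.relG G) (Q.relG G)

  Nonempty-∪ˡ : {H : Subset k} (G : Subset k) → Nonempty H → Nonempty (H ∪ G)
  Nonempty-∪ˡ G (j , j∈H) = j , p⊆p∪q G j∈H

  Bisimulation-updP : ∀ {P Q Z} → Bisimulation P Q Z → ∀ G → Nonempty G →
                      Bisimulation (updP P G) (updP Q G) Z
  Bisimulation-updP {P} {Q} {Z} bisim G G≠∅ = record
    { atoms = atoms ; forthA = forthA′ ; backA = backA′ ; forthG = forthG′ ; backG = backG′ }
    where
    open Bisimulation bisim
    forthA′ : ∀ i → Forth Z (PreFrame.relA (updP P G) i) (PreFrame.relA (updP Q G) i)
    forthA′ i with i ∈? G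
    ... | yes _ = forthG G G≠∅
    ... | no  _ = forthA i
    backA′ : ∀ i → Back Z (PreFrame.relA (updP P G) i) (PreFrame.relA (updP Q G) i)
    backA′ i with i ∈? G
    ... | yes _ = backG G G≠∅
    ... | no  _ = backA i
    forthG′ : ∀ H → Nonempty H → Forth Z (PreFrame.relG (updP P G) H) (PreFrame.relG (updP Q G) H)
    forthG′ H H≠∅ with nonempty? (H ∩ G)
    ... | yes _ = forthG (H ∪ G) (Nonempty-∪ˡ G H≠∅)
    ... | no  _ = forthG H H≠∅
    backG′ : ∀ H → Nonempty H → Back Z (PreFrame.relG (updP P G) H) (PreFrame.relG (updP Q G) H)
    backG′ H H≠∅ with nonempty? (H ∩ G)
    ... | yes _ = backG (H ∪ G) (Nonempty-∪ˡ G H≠∅)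
    ... | no  _ = backG H H≠∅

  ⊨ₚ-invariant : ∀ {P Q Z} → Bisimulation P Q Z → ∀ φ {x y} → Z x y → (P , x ⊨ₚ φ) ⇔ (Q , y ⊨ₚ φ)
  ⊨ₚ-invariant bisim (atom p)   z = Bisimulation.atoms bisim z p
  ⊨ₚ-invariant bisim (¬' φ)     z = ¬-cong-⇔ (⊨ₚ-invariant bisim φ z)
  ⊨ₚ-invariant bisim (φ ∧' ψ)   z = ⊨ₚ-invariant bisim φ z ×-⇔ ⊨ₚ-invariant bisim ψ z
  ⊨ₚ-invariant bisim (K i φ)    z =
    □-cong (Bisimulation.forthA bisim i) (Bisimulation.backA bisim i) (⊨ₚ-invariant bisim φ) z
  ⊨ₚ-invariant bisim (D G G≠∅ φ) z =
    □-cong (Bisimulation.forthG bisim G G≠∅) (Bisimulation.backG bisim G G≠∅) (⊨ₚ-invariant bisim φ) z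
  ⊨ₚ-invariant {P} {Q} {Z} bisim (C G _ φ) z =
    □-cong (Star-forth union-forth) (Star-forth union-back) (⊨ₚ-invariant bisim φ) z
    where
    open Bisimulation bisim
    union-forth : Forth Z (unionStepP P G) (unionStepP Q G)
    union-forth z (i , i∈G , r) = let y' , z' , s = forthA i z r in y' , z' , (i , i∈G , s)
    union-back : Back Z (unionStepP P G) (unionStepP Q G)
    union-back z (i , i∈G , s) = let x' , z' , r = backA i z s in x' , z' , (i , i∈G , r)
  ⊨ₚ-invariant bisim (R G G≠∅ φ) z = ⊨ₚ-invariant (Bisimulation-updP bisim G G≠∅) φ z

  asPreFrame : Frame {k} → PreFrame {k}
  asPreFrame F = record { N = Frame.W F ; relA = Frame.rel F ; relG = relGrp F ; ν = Frame.V F }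

  module _ (F : Frame {k}) (G : Subset k) {x y : Frame.W F} where

    updM-rel-∈ : ∀ {j} → j ∈ G → Frame.rel (updM F G) j x y ⇔ relGrp F G x y
    updM-rel-∈ {j} j∈G with j ∈? G
    ... | yes _   = ⇔.refl
    ... | no  j∉G = contradiction j∈G j∉G

    updM-rel-∉ : ∀ {j} → j ∉ G → Frame.rel (updM F G) j x y ⇔ Frame.rel F j x y
    updM-rel-∉ {j} j∉G with j ∈? G
    ... | yes j∈G = contradiction j∈G j∉G
    ... | no  _   = ⇔.refl

    relGrp-updM-meets : ∀ {H} → Nonempty (H ∩ G) → relGrp (updM F G) H x y ⇔ relGrp F (H ∪ G) x y
    relGrp-updM-meets {H} (j₀ , j₀∈H∩G) = mk⇔ to′ from′
      where
      to′ : relGrp (updM F G) H x y → relGrp F (H ∪ G) x y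
      to′ r j j∈H∪G with x∈p∪q⁻ H G j∈H∪G | x∈p∩q⁻ H G j₀∈H∩G
      ... | inj₂ j∈G | j₀∈H , j₀∈G = to (updM-rel-∈ j₀∈G) (r j₀ j₀∈H) j j∈G
      ... | inj₁ j∈H | _ with j ∈? G
      ...   | yes j∈G = to (updM-rel-∈ j∈G) (r j j∈H) j j∈G
      ...   | no  j∉G = to (updM-rel-∉ j∉G) (r j j∈H)
      from′ : relGrp F (H ∪ G) x y → relGrp (updM F G) H x y
      from′ r j j∈H with j ∈? G
      ... | yes _ = λ l l∈G → r l (q⊆p∪q H G l∈G)
      ... | no  _ = r j (p⊆p∪q G j∈H)

    relGrp-updM-disjoint : ∀ {H} → ¬ Nonempty (H ∩ G) → relGrp (updM F G) H x y ⇔ relGrp F H x y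
    relGrp-updM-disjoint {H} H∩G=∅ = mk⇔
      (λ r j j∈H → to (updM-rel-∉ (j∉G j∈H)) (r j j∈H))
      (λ r j j∈H → from (updM-rel-∉ (j∉G j∈H)) (r j j∈H))
      where
      j∉G : ∀ {j} → j ∈ H → j ∉ G
      j∉G j∈H j∈G = H∩G=∅ (_ , x∈p∩q⁺ (j∈H , j∈G))

    relA-updM⇔updP : ∀ j → Frame.rel (updM F G) j x y ⇔ PreFrame.relA (updP (asPreFrame F) G) j x y
    relA-updM⇔updP j with j ∈? G
    ... | yes _ = ⇔.refl
    ... | no  _ = ⇔.refl

    relG-updM⇔updP : ∀ H → relGrp (updM F G) H x y ⇔ PreFrame.relG (updP (asPreFrame F) G) H x y
    relG-updM⇔updP H with nonempty? (H ∩ G)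
    ... | yes H∩G≠∅ = relGrp-updM-meets H∩G≠∅
    ... | no  H∩G=∅ = relGrp-updM-disjoint H∩G=∅

  updM-updP-bisimulation : ∀ F G → Bisimulation (asPreFrame (updM F G)) (updP (asPreFrame F) G) _≡_
  updM-updP-bisimulation F G = record
    { atoms  = λ { refl _ → ⇔.refl }
    ; forthA = λ j → ≡-forth (to (relA-updM⇔updP F G j))
    ; backA  = λ j → ≡-back (from (relA-updM⇔updP F G j))
    ; forthG = λ H _ → ≡-forth (to (relG-updM⇔updP F G H))
    ; backG  = λ H _ → ≡-back (from (relG-updM⇔updP F G H))
    }

  ⊨⇔⊨ₚ-asPreFrame : ∀ F φ x → (F , x ⊨ φ) ⇔ (asPreFrame F , x ⊨ₚ φ)
  ⊨⇔⊨ₚ-asPreFrame F (atom p)    x = ⇔.refl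
  ⊨⇔⊨ₚ-asPreFrame F (¬' φ)      x = ¬-cong-⇔ (⊨⇔⊨ₚ-asPreFrame F φ x)
  ⊨⇔⊨ₚ-asPreFrame F (φ ∧' ψ)    x = ⊨⇔⊨ₚ-asPreFrame F φ x ×-⇔ ⊨⇔⊨ₚ-asPreFrame F ψ x
  ⊨⇔⊨ₚ-asPreFrame F (K i φ)     x = □-cong-pointwise (⊨⇔⊨ₚ-asPreFrame F φ)
  ⊨⇔⊨ₚ-asPreFrame F (D G _ φ)   x = □-cong-pointwise (⊨⇔⊨ₚ-asPreFrame F φ)
  ⊨⇔⊨ₚ-asPreFrame F (C G _ φ)   x = □-cong-pointwise (⊨⇔⊨ₚ-asPreFrame F φ)
  ⊨⇔⊨ₚ-asPreFrame F (R G _ φ)   x =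
    ⇔.trans (⊨⇔⊨ₚ-asPreFrame (updM F G) φ x) (⊨ₚ-invariant (updM-updP-bisimulation F G) φ refl)

  IsBisim⇒Bisimulation : ∀ {P Q Z} → IsBisim P Q Z →
                         Bisimulation (PreModel.frame P) (PreModel.frame Q) Z
  IsBisim⇒Bisimulation bisim = record
    { atoms  = λ z → atoms _ _ z
    ; forthA = λ i z r → forthA _ _ z i _ r
    ; backA  = λ i z s → backA _ _ z i _ s
    ; forthG = λ G G≠∅ z r → forthG _ _ z G G≠∅ _ r
    ; backG  = λ G G≠∅ z s → backG _ _ z G G≠∅ _ s
    }
    where open IsBisim bisim

  module _ {P Q : PreModel {k}} {Z : PreModel.N P → PreModel.N Q → Set}
           (bisim : IsBisim P Q Z) where
    open Bisimulation (IsBisim⇒Bisimulation bisim)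

    agStep-forth : ∀ i → Forth Z (agStep P i) (agStep Q i)
    agStep-forth i z (inj₁ r) = let y' , z' , s = forthA i z r in y' , z' , inj₁ s
    agStep-forth i z (inj₂ (H , i∈H , r)) =
      let y' , z' , s = forthG H (i , i∈H) z r in y' , z' , inj₂ (H , i∈H , s)

    grStep-forth : ∀ {G} → Nonempty G → Forth Z (grStep P G) (grStep Q G)
    grStep-forth (j , j∈G) z (H , G⊆H , r) =
      let y' , z' , s = forthG H (j , G⊆H j∈G) z r in y' , z' , (H , G⊆H , s)

  module _ {S : PreModel {k}} (pseudo : IsPseudo S) where
    open PreModel S
    open IsPseudo pseudo

    agStep⁺⇒relA : ∀ {i x y} → Plus (agStep S i) x y → relA i x y
    agStep⁺⇒relA {i} path = Plus-fold step (IsEquivalence.trans (equivA i)) path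
      where
      step : ∀ {x y} → agStep S i x y → relA i x y
      step (inj₁ r) = r
      step (inj₂ (H , i∈H , r)) = to (single i _ _) (anti ⁅ i ⁆ H (i , x∈⁅x⁆ i) (⁅⁆⊆ i∈H) _ _ r)

    grStep⁺⇒relG : ∀ {G x y} → Nonempty G → Plus (grStep S G) x y → relG G x y
    grStep⁺⇒relG {G} G≠∅ =
      Plus-fold (λ (H , G⊆H , r) → anti G H G≠∅ G⊆H _ _ r) (IsEquivalence.trans (equivG G G≠∅))

    relA⇒relG : ∀ {i G x y} → Nonempty G → G ⊆ ⁅ i ⁆ → relA i x y → relG G x y
    relA⇒relG {i} {G} G≠∅ G⊆⁅i⁆ r = anti G ⁅ i ⁆ G≠∅ G⊆⁅i⁆ _ _ (from (single i _ _) r)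

  module _ {M : Model {k}} {N S : PreModel {k}} (pseudo : IsPseudo S)
           {Z : Model.W M → PreModel.N N → Set} (transBisim : IsTransBisim M N Z)
           {Y : PreModel.N N → PreModel.N S → Set} (bisim : IsBisim N S Y) where
    private
      module M = Model M
      module S = PreModel S
      open IsTransBisim transBisim
      module N≈S = Bisimulation (IsBisim⇒Bisimulation bisim)

    Z⨾Y : M.W → S.N → Set
    Z⨾Y m s = ∃[ n ] Z m n × Y n s

    transBisim⨾bisim : Bisimulation (asPreFrame M.frame) S.frame Z⨾Y
    transBisim⨾bisim = record
      { atoms  = λ (_ , z , y) p → ⇔.trans (at _ _ z p) (N≈S.atoms y p)
      ; forthA = forthA
      ; backA  = backA
      ; forthG = forthG
      ; backG  = backG
      }
      where
      forthA : ∀ i → Forth Z⨾Y (M.rel i) (S.relA i)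
      forthA i (_ , z , y) r =
        let n' , z' , path = zigAg _ _ z i _ r
            s' , y' , path' = Plus-forth (agStep-forth bisim i) y path
        in s' , (n' , z' , y') , agStep⁺⇒relA pseudo path'
      forthG : ∀ G → Nonempty G → Forth Z⨾Y (relGrp M.frame G) (S.relG G)
      forthG G G≠∅ (n , z , y) r with 2 ≤? ∣ G ∣
      ... | yes 2≤∣G∣ =
        let n' , z' , path = zigGr _ _ z G 2≤∣G∣ _ r
            s' , y' , path' = Plus-forth (grStep-forth bisim G≠∅) y path
        in s' , (n' , z' , y') , grStep⁺⇒relG pseudo G≠∅ path'
      ... | no ∣G∣<2 =
        let i , i∈G = G≠∅
            s' , w , s = forthA i (n , z , y) (r i i∈G)
        in s' , w , relA⇒relG pseudo G≠∅ (∣∣<2⇒⊆⁅⁆ i∈G ∣G∣<2) s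
      backA : ∀ i → Back Z⨾Y (M.rel i) (S.relA i)
      backA i (_ , z , y) s =
        let n' , y' , r = N≈S.backA i y s
            m' , z' , r' = zagAg _ _ z i n' r
        in m' , (n' , z' , y') , r'
      backG : ∀ G → Nonempty G → Back Z⨾Y (relGrp M.frame G) (S.relG G)
      backG G G≠∅ (_ , z , y) s =
        let n' , y' , r = N≈S.backG G G≠∅ y s
            m' , z' , r' = zagGr _ _ z G G≠∅ n' r
        in m' , (n' , z' , y') , r'

lemma6 : {k : ℕ} (M : Model {k}) (m : Model.W M)
         (N : PreModel {k}) (n : PreModel.N N)
         (S : PreModel {k}) (s : PreModel.N S) → IsPseudo S →
         TransBisimilar M m N n → Bisimilar N n S s →
         (φ : Form {k}) → (Model.frame M , m ⊨ φ) ⇔ (PreModel.frame N , n ⊨ₚ φ)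
lemma6 M m N n S s pseudo (Z , transBisim , z) (Y , bisim , y) φ =
  ⇔.trans (⊨⇔⊨ₚ-asPreFrame (Model.frame M) φ m)
    (⇔.trans (⊨ₚ-invariant (transBisim⨾bisim pseudo transBisim bisim) φ (n , z , y))
      (⇔.sym (⊨ₚ-invariant (IsBisim⇒Bisimulation bisim) φ y)))
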